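{- \[1+\sum_{n\ge1}|\mathrm{SAv}_n(321,3412)|x^n=\frac{1}{1-x-x^2-2x^3}.\]
   Context: Permutations $\pi\in S_n$ are identified with words $\pi(1)\cdots\pi(n)$. For $\tau\in S_m$, entries $\pi(i_1),\ldots,\pi(i_m)$ with $i_1<\cdots<i_m$ form an occurrence of $\tau$ if for all $j,l$, $\pi(i_j)<\pi(i_l)$ iff $\tau(j)<\tau(l)$; $\pi$ avoids $\tau$ if there is no occurrence. $\mathrm{SAv}_n(\tau_1,\ldots,\tau_r)$ is the set of $\pi\in S_n$ such that both $\pi$ and $\pi^2=\pi\circ\pi$ avoid each of $\tau_1,\ldots,\tau_r$. -}

module Defs where

open import Data.Bool using (Bool; true; false; _∧_; _∨_; not; if_then_else_)
open import Data.Nat using (ℕ; zero; suc; _+_; _*_; _<ᵇ_; _≡ᵇ_)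
open import Data.Fin using (Fin; toℕ)
open import Data.List using (List; []; _∷_; map; filter; length; concatMap; zip; allFin)
open import Data.Bool.ListAction using (all; any)
open import Data.Vec using (Vec; lookup; tabulate; toList)
import Data.Vec as V
open import Data.Product using (_,_; _×_)
open import Relation.Nullary.Decidable using (Dec)
open import Data.Bool.Properties using (T?)

-- A permutation π ∈ S_n is identified with its word π(1)⋯π(n), here a
-- vector of length n with entries in Fin n (values 0..n-1, 0-based).

allWords : (n k : ℕ) → List (Vec (Fin n) k)
allWords n zero = V.[] ∷ []
allWords n (suc k) = concatMap (λ x → map (x V.∷_) (allWords n k)) (allFin n)

_≟ᵇ_ : ℕ → ℕ → Bool
_≟ᵇ_ = _≡ᵇ_

_⇔ᵇ_ : Bool → Bool → Bool
true ⇔ᵇ b = b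
false ⇔ᵇ b = not b

-- the word is a permutation: its entries are pairwise distinct
-- (an injective map Fin n → Fin n is a bijection)
distinct : List ℕ → Bool
distinct [] = true
distinct (x ∷ xs) = all (λ y → not (x ≡ᵇ y)) xs ∧ distinct xs

isPerm : ∀ {n} → Vec (Fin n) n → Bool
isPerm w = distinct (map toℕ (toList w))

square : ∀ {n} → Vec (Fin n) n → Vec (Fin n) n
square w = tabulate (λ i → lookup w (lookup w i))

orderIso : List ℕ → List ℕ → Bool
orderIso [] [] = true
orderIso (x ∷ xs) (y ∷ ys) =
  all (λ p → let (x' , y') = p in
               ((x <ᵇ x') ⇔ᵇ (y <ᵇ y')) ∧ ((x' <ᵇ x) ⇔ᵇ (y' <ᵇ y)))
      (zip xs ys)
  ∧ orderIso xs ys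
orderIso _ _ = false

-- all subsequences of length m of a list (these, applied to the list of
-- entries of π, give the entries π(i_1),…,π(i_m) for i_1 < ⋯ < i_m)
subseqs : {A : Set} → ℕ → List A → List (List A)
subseqs zero _ = [] ∷ []
subseqs (suc m) [] = []
subseqs (suc m) (x ∷ xs) = map (x ∷_) (subseqs m xs) Data.List.++ subseqs (suc m) xs

contains : ∀ {n} → Vec (Fin n) n → List ℕ → Bool
contains w τ = any (λ s → orderIso s τ) (subseqs (length τ) (map toℕ (toList w)))

avoids : ∀ {n} → Vec (Fin n) n → List ℕ → Bool
avoids w τ = not (contains w τ)

avoidsAll : ∀ {n} → Vec (Fin n) n → List (List ℕ) → Bool
avoidsAll w τs = all (avoids w) τs

inSAv : ∀ {n} → List (List ℕ) → Vec (Fin n) n → Bool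
inSAv τs w = isPerm w ∧ avoidsAll w τs ∧ avoidsAll (square w) τs

sav : List (List ℕ) → ℕ → ℕ
sav τs n = length (filter (λ w → T? (inSAv τs w)) (allWords n n))

p321 : List ℕ
p321 = 3 ∷ 2 ∷ 1 ∷ []

p3412 : List ℕ
p3412 = 3 ∷ 4 ∷ 1 ∷ 2 ∷ []

-- coefficients of 1/(1 - x - x^2 - 2x^3) = Σ c n x^n:
-- c 0 = 1, c 1 = 1, c 2 = 2, c (n+3) = c (n+2) + c (n+1) + 2 c n
coeff : ℕ → ℕ
coeff zero = 1
coeff (suc zero) = 1
coeff (suc (suc zero)) = 2
coeff (suc (suc (suc n))) = coeff (suc (suc n)) + coeff (suc n) + 2 * coeff n

module Submission where

-- A permutation π with π and π² both avoiding 321 and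
-- 3412 is a concatenation of the blocks 0, 10, 120, 201, each block raised
-- past the letters before it; conversely every such concatenation lies in
-- SAv(321, 3412).  Hence |SAv_n| = c(n), where c counts block words of length
-- n: c(n+3) = c(n+2) + c(n+1) + 2c(n), the two blocks of length 3 giving the
-- factor 2.

open import Defs
open import Data.Bool using (Bool; true; false; _∧_; not; T)
open import Data.Bool.Properties using (T-∧; T-≡)
open import Data.Bool.ListAction using (any)
open import Data.Empty using (⊥; ⊥-elim)
open import Data.Fin using (Fin; toℕ; fromℕ<) renaming (zero to fzero; suc to fsuc)
open import Data.Fin.Properties using (toℕ<n; toℕ-injective; toℕ-fromℕ<)
open import Data.Nat
open import Data.Nat.Induction using (<-rec)
open import Data.Nat.Properties
open import Data.List using (List; []; _∷_; map; length; _++_; zip; filter; upTo)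
import Data.List as List
open import Data.List.Properties
  using (length-map; length-++; length-upTo; filter-notAll; map-++; map-∘; map-cong-local; map-injective;
         ++-cancelˡ; tabulate-cong; ∷-injectiveˡ; ∷-injectiveʳ)
open import Data.List.Membership.Propositional using (_∈_; find; lose)
open import Data.List.Membership.Propositional.Properties
  using (∈-++⁺ˡ; ∈-++⁺ʳ; ∈-++⁻; ∈-map⁺; ∈-map⁻; ∈-filter⁺; ∈-filter⁻; ∈-upTo⁺; ∈-concat⁺′; ∈-allFin)
open import Data.List.Membership.DecPropositional _≟_ using (_∈?_)
open import Data.List.Membership.Propositional.Properties.WithK using (unique∧set⇒bag)
open import Data.List.Relation.Binary.BagAndSetEquality using (∼bag⇒↭)
open import Data.List.Relation.Binary.Permutation.Propositional.Properties using (↭-length)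
open import Data.List.Relation.Binary.Sublist.Propositional using (_⊆_; []; _∷_; _∷ʳ_; minimum)
open import Data.List.Relation.Binary.Sublist.Propositional.Properties using (All-resp-⊆; length-mono-≤)
open import Data.List.Relation.Unary.All
  using (All; []; _∷_; lookup) renaming (map to All-map; tabulate to All-tabulate)
import Data.List.Relation.Unary.All.Properties as All
open import Data.List.Relation.Unary.AllPairs using () renaming (map to AllPairs-map)
import Data.List.Relation.Unary.AllPairs.Properties as AllPairs
open import Data.List.Relation.Unary.Any using (here; there) renaming (map to Any-map)
open import Data.List.Relation.Unary.Any.Properties using (any⁺; any⁻)
open import Data.List.Relation.Unary.Unique.Propositional using (Unique; []; _∷_)
import Data.List.Relation.Unary.Unique.Propositional.Properties as Unique
open import Data.Product using (∃-syntax; _×_; _,_; proj₁; proj₂)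
open import Data.Sum using (_⊎_; inj₁; inj₂)
open import Data.Unit using (tt)
open import Data.Vec using (Vec)
import Data.Vec as Vec
import Data.Vec.Properties as Vec
open import Function using (_∘_; Equivalence)
open import Function.Bundles using (mk⇔)
open import Relation.Binary using (Tri; tri<; tri≈; tri>)
open import Relation.Binary.PropositionalEquality
open import Relation.Nullary using (¬_; yes; no)
open import Relation.Nullary.Decidable using (T?)

-- Words are lists of naturals; xs ! i is the entry at position i (0 past
-- the end), and squareL xs is the word of the square: (π²)(i) = π(π(i)).
_!_ : List ℕ → ℕ → ℕ
[] ! _ = 0
(x ∷ xs) ! zero = x
(x ∷ xs) ! suc i = xs ! i

squareL : List ℕ → List ℕ
squareL xs = map (xs !_) xs

-- The containment test of Defs on a list of entries: contains w τ is
-- definitionally containsL (map toℕ (toList w)) τ.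
containsL : List ℕ → List ℕ → Bool
containsL xs τ = any (λ s → orderIso s τ) (subseqs (length τ) xs)

Has321 : List ℕ → Set
Has321 xs = ∃[ x ] ∃[ y ] ∃[ z ] (x ∷ y ∷ z ∷ []) ⊆ xs × z < y × y < x

Has3412 : List ℕ → Set
Has3412 xs = ∃[ x ] ∃[ y ] ∃[ z ] ∃[ w ] (x ∷ y ∷ z ∷ w ∷ []) ⊆ xs × z < w × w < x × x < y

subseqs-complete : ∀ {A : Set} {s xs : List A} → s ⊆ xs → s ∈ subseqs (length s) xs
subseqs-complete [] = here refl
subseqs-complete {s = []} (_ ∷ʳ sub) = here refl
subseqs-complete {s = _ ∷ _} (_ ∷ʳ sub) = ∈-++⁺ʳ _ (subseqs-complete sub)
subseqs-complete (refl ∷ sub) = ∈-++⁺ˡ (∈-map⁺ _ (subseqs-complete sub))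

subseqs-sound : ∀ {A : Set} m (xs : List A) {s} → s ∈ subseqs m xs → s ⊆ xs × length s ≡ m
subseqs-sound zero xs (here refl) = minimum xs , refl
subseqs-sound (suc m) (x ∷ xs) mem with ∈-++⁻ (map (x ∷_) (subseqs m xs)) mem
... | inj₂ later = let sub , len = subseqs-sound (suc m) xs later in x ∷ʳ sub , len
... | inj₁ first with ∈-map⁻ (x ∷_) first
...   | t , t∈ , refl = let sub , len = subseqs-sound m xs t∈ in refl ∷ sub , cong suc len

∧-fst : ∀ {a b} → T (a ∧ b) → T a
∧-fst = proj₁ ∘ Equivalence.to T-∧

∧-snd : ∀ {a b} → T (a ∧ b) → T b
∧-snd {a} = proj₂ ∘ Equivalence.to (T-∧ {a})

⇔ᵇ-true : ∀ {a} → T (a ⇔ᵇ true) → T a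
⇔ᵇ-true {true} t = t

<ᵇ-true : ∀ {m n} → m < n → (m <ᵇ n) ≡ true
<ᵇ-true = Equivalence.to T-≡ ∘ <⇒<ᵇ

<ᵇ-false : ∀ {m n} → n ≤ m → (m <ᵇ n) ≡ false
<ᵇ-false {m} {n} n≤m with m <ᵇ n in e
... | false = refl
... | true = ⊥-elim (<⇒≱ (<ᵇ⇒< m n (subst T (sym e) tt)) n≤m)

comparesLike : ℕ → ℕ → ℕ × ℕ → Bool
comparesLike x y (x' , y') = ((x <ᵇ x') ⇔ᵇ (y <ᵇ y')) ∧ ((x' <ᵇ x) ⇔ᵇ (y' <ᵇ y))

orderIso-∷ : ∀ x xs y ys → T (orderIso (x ∷ xs) (y ∷ ys)) →
             All (T ∘ comparesLike x y) (zip xs ys) × T (orderIso xs ys)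
orderIso-∷ x xs y ys t = All.all⁺ (comparesLike x y) (zip xs ys) (∧-fst t) , ∧-snd t

comparesLike-> : ∀ x y x' y' → y' < y → T (comparesLike x y (x' , y')) → x' < x
comparesLike-> x y x' y' y'<y t rewrite <ᵇ-true y'<y = <ᵇ⇒< x' x (⇔ᵇ-true (∧-snd t))

comparesLike-< : ∀ x y x' y' → y < y' → T (comparesLike x y (x' , y')) → x < x'
comparesLike-< x y x' y' y<y' t rewrite <ᵇ-true y<y' = <ᵇ⇒< x x' (⇔ᵇ-true (∧-fst t))

iso321 : ∀ {x y z} → z < y → y < x → T (orderIso (x ∷ y ∷ z ∷ []) p321)
iso321 {x} {y} {z} z<y y<x
  rewrite <ᵇ-false {x} {y} (<⇒≤ y<x) | <ᵇ-true y<x | <ᵇ-false {x} {z} (<⇒≤ (<-trans z<y y<x))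
        | <ᵇ-true (<-trans z<y y<x) | <ᵇ-false {y} {z} (<⇒≤ z<y) | <ᵇ-true z<y = tt

iso321⁻ : ∀ {x y z} → T (orderIso (x ∷ y ∷ z ∷ []) p321) → z < y × y < x
iso321⁻ {x} {y} {z} t with orderIso-∷ x (y ∷ z ∷ []) 3 (2 ∷ 1 ∷ []) t
... | x>y ∷ _ , rest with orderIso-∷ y (z ∷ []) 2 (1 ∷ []) rest
...   | y>z ∷ _ , _ = comparesLike-> y 2 z 1 (n<1+n 1) y>z , comparesLike-> x 3 y 2 (n<1+n 2) x>y

iso3412 : ∀ {x y z w} → z < w → w < x → x < y → T (orderIso (x ∷ y ∷ z ∷ w ∷ []) p3412)
iso3412 {x} {y} {z} {w} z<w w<x x<y = go (<-trans z<w w<x) (<-trans w<x x<y) (<-trans (<-trans z<w w<x) x<y)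
  where
  go : z < x → w < y → z < y → T (orderIso (x ∷ y ∷ z ∷ w ∷ []) p3412)
  go z<x w<y z<y
    rewrite <ᵇ-true x<y | <ᵇ-false {y} {x} (<⇒≤ x<y)
          | <ᵇ-false {x} {z} (<⇒≤ z<x) | <ᵇ-true z<x
          | <ᵇ-false {x} {w} (<⇒≤ w<x) | <ᵇ-true w<x
          | <ᵇ-false {y} {z} (<⇒≤ z<y) | <ᵇ-true z<y
          | <ᵇ-false {y} {w} (<⇒≤ w<y) | <ᵇ-true w<y
          | <ᵇ-true z<w | <ᵇ-false {w} {z} (<⇒≤ z<w) = tt

iso3412⁻ : ∀ {x y z w} → T (orderIso (x ∷ y ∷ z ∷ w ∷ []) p3412) → z < w × w < x × x < y
iso3412⁻ {x} {y} {z} {w} t with orderIso-∷ x (y ∷ z ∷ w ∷ []) 3 (4 ∷ 1 ∷ 2 ∷ []) t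
... | x<y ∷ _ ∷ x>w ∷ [] , rest with orderIso-∷ y (z ∷ w ∷ []) 4 (1 ∷ 2 ∷ []) rest
...   | _ , rest' with orderIso-∷ z (w ∷ []) 1 (2 ∷ []) rest'
...     | z<w ∷ [] , _ = comparesLike-< z 1 w 2 (n<1+n 1) z<w
                       , comparesLike-> x 3 w 2 (n<1+n 2) x>w
                       , comparesLike-< x 3 y 4 (n<1+n 3) x<y

has321⇒contains : ∀ {xs} → Has321 xs → T (containsL xs p321)
has321⇒contains (_ , _ , _ , sub , z<y , y<x) = any⁺ _ (lose (subseqs-complete sub) (iso321 z<y y<x))

contains⇒has321 : ∀ xs → T (containsL xs p321) → Has321 xs
contains⇒has321 xs t with find (any⁻ _ _ t)
... | s , mem , iso with subseqs-sound 3 xs mem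
...   | sub , len with s | len
...     | x ∷ y ∷ z ∷ [] | refl = x , y , z , sub , iso321⁻ iso

has3412⇒contains : ∀ {xs} → Has3412 xs → T (containsL xs p3412)
has3412⇒contains (_ , _ , _ , _ , sub , z<w , w<x , x<y) =
  any⁺ _ (lose (subseqs-complete sub) (iso3412 z<w w<x x<y))

contains⇒has3412 : ∀ xs → T (containsL xs p3412) → Has3412 xs
contains⇒has3412 xs t with find (any⁻ _ _ t)
... | s , mem , iso with subseqs-sound 4 xs mem
...   | sub , len with s | len
...     | x ∷ y ∷ z ∷ w ∷ [] | refl = x , y , z , w , sub , iso3412⁻ iso

Avoids321 : (ℕ → ℕ) → ℕ → Set
Avoids321 f n = ∀ {i j k} → i < j → j < k → k < n → f k < f j → f j < f i → ⊥

Avoids3412 : (ℕ → ℕ) → ℕ → Set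
Avoids3412 f n = ∀ {i j k l} → i < j → j < k → k < l → l < n →
                 f k < f l → f l < f i → f i < f j → ⊥

record SAvPerm (π : ℕ → ℕ) (n : ℕ) : Set where
  field
    into      : ∀ {x} → x < n → π x < n
    injective : ∀ {x y} → x < n → y < n → π x ≡ π y → x ≡ y
    preimage  : ∀ {v} → v < n → ∃[ x ] x < n × π x ≡ v
    π-321     : Avoids321 π n
    π-3412    : Avoids3412 π n
    π²-321    : Avoids321 (λ x → π (π x)) n
    π²-3412   : Avoids3412 (λ x → π (π x)) n

value<size : ∀ {π n x v} → SAvPerm π n → x < n → π x ≡ v → v < n
value<size {n = n} H x<n πx≡v = subst (_< n) πx≡v (SAvPerm.into H x<n)

FirstBlock : (ℕ → ℕ) → Set
FirstBlock π = π 0 ≡ 0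
             ⊎ (π 0 ≡ 1 × π 1 ≡ 0)
             ⊎ (π 0 ≡ 1 × π 1 ≡ 2 × π 2 ≡ 0)
             ⊎ (π 0 ≡ 2 × π 1 ≡ 0 × π 2 ≡ 1)

<-by : ∀ {p q u v : ℕ} → p ≡ u → q ≡ v → u < v → p < q
<-by refl refl u<v = u<v

>1 : ∀ {m} → m ≢ 0 → m ≢ 1 → 1 < m
>1 {m} m≢0 m≢1 = ≤∧≢⇒< (n≢0⇒n>0 m≢0) (m≢1 ∘ sym)

>2 : ∀ {m} → m ≢ 0 → m ≢ 1 → m ≢ 2 → 2 < m
>2 {0} m≢0 _ _ = ⊥-elim (m≢0 refl)
>2 {1} _ m≢1 _ = ⊥-elim (m≢1 refl)
>2 {2} _ _ m≢2 = ⊥-elim (m≢2 refl)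
>2 {suc (suc (suc m))} _ _ _ = s≤s (s≤s (s≤s z≤n))

three≤ : ∀ k → 3 ≤ suc (suc (suc k))
three≤ k = s≤s (s≤s (s≤s z≤n))

-- Its proof locates the values 0, 1, 2 and exhibits a
-- forbidden pattern in π or π² in every other configuration.
module FirstBlockLemma {π : ℕ → ℕ} {n : ℕ} (H : SAvPerm π n) (0<n : 0 < n) where
  open SAvPerm H

  positions-differ : ∀ {x y u v} → π x ≡ u → π y ≡ v → u ≢ v → x ≢ y
  positions-differ πx≡u πy≡v u≢v refl = u≢v (trans (sym πx≡u) πy≡v)

  squared : ∀ {x u w} → π x ≡ u → π u ≡ w → π (π x) ≡ w
  squared πx≡u πu≡w = trans (cong π πx≡u) πu≡w

  -- Two values below π(0) occur in increasing order of position;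
  -- otherwise, together with π(0), they would form a 321.
  belowFirstIncreasing : ∀ {a u v p q} → π 0 ≡ a → u < v → v < a →
                         π p ≡ u → π q ≡ v → p < n → p < q
  belowFirstIncreasing {p = p} {q} π0≡a u<v v<a πp≡u πq≡v p<n with <-cmp p q
  ... | tri< p<q _ _ = p<q
  ... | tri≈ _ p≡q _ = ⊥-elim (positions-differ πp≡u πq≡v (<⇒≢ u<v) p≡q)
  ... | tri> _ _ q<p = ⊥-elim (π-321 0<q q<p p<n (<-by πp≡u πq≡v u<v) (<-by πq≡v π0≡a v<a))
    where
    0<q = n≢0⇒n>0 (positions-differ πq≡v π0≡a (<⇒≢ v<a))

  -- The entries before the position of the value 0 are increasing;
  -- otherwise two of them, together with 0, would form a 321.
  beforeZeroIncreasing : ∀ {i k j} → π j ≡ 0 → i < k → k < j → j < n → π i < π k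
  beforeZeroIncreasing {i} {k} {j} πj≡0 i<k k<j j<n with <-cmp (π i) (π k)
  ... | tri< lt _ _ = lt
  ... | tri≈ _ eq _ = ⊥-elim (<⇒≢ i<k (injective (<-trans i<k k<n) k<n eq))
    where k<n = <-trans k<j j<n
  ... | tri> _ _ gt = ⊥-elim (π-321 i<k k<j j<n (<-by πj≡0 refl πk>0) gt)
    where
    πk>0 : 0 < π k
    πk>0 = n≢0⇒n>0 λ πk≡0 → <⇒≢ k<j (injective (<-trans k<j j<n) j<n (trans πk≡0 (sym πj≡0)))

  -- Claim 1: π(0) ≤ 2.  Suppose π(0) = a ≥ 3; the values 0 < 1 < 2 lie
  -- below a, so their positions p₀ < p₁ < p₂ increase.
  module _ {a : ℕ} (π0≡a : π 0 ≡ a) (3≤a : 3 ≤ a) where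
    private
      a<n = value<size H 0<n π0≡a
      2<n = <-≤-trans 3≤a (<⇒≤ a<n)
      1<n = <-trans (n<1+n 1) 2<n
      2<a = 3≤a
      1<a = <-trans (n<1+n 1) 2<a
      0<a = <-trans (n<1+n 0) 1<a

    -- If π(1) = b ≠ 0, then 0 lies at a position p₀ > 1, and π(0) π(1) 0 is a
    -- 321 (when b < a) or π(0) π(1) 0 1 is a 3412 (when b > a).
    firstLarge-secondNonzero : ∀ {b p₀ p₁} → π 1 ≡ b → b ≢ 0 →
                               π p₀ ≡ 0 → π p₁ ≡ 1 → p₀ < n → p₁ < n → ⊥
    firstLarge-secondNonzero {b} {p₀} {p₁} π1≡b b≢0 πp₀≡0 πp₁≡1 p₀<n p₁<n = compareWithFirst (<-cmp b a)
      where
      p₀<p₁ = belowFirstIncreasing π0≡a (n<1+n 0) 1<a πp₀≡0 πp₁≡1 p₀<n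
      1<p₀ = >1 (positions-differ πp₀≡0 π0≡a (<⇒≢ 0<a)) (positions-differ πp₀≡0 π1≡b (b≢0 ∘ sym))
      compareWithFirst : Tri (b < a) (b ≡ a) (a < b) → ⊥
      compareWithFirst (tri< b<a _ _) = π-321 (n<1+n 0) 1<p₀ p₀<n (<-by πp₀≡0 π1≡b (n≢0⇒n>0 b≢0))
                                                           (<-by π1≡b π0≡a b<a)
      compareWithFirst (tri≈ _ b≡a _) = 1+n≢0 (injective 1<n 0<n (trans π1≡b (trans b≡a (sym π0≡a))))
      compareWithFirst (tri> _ _ a<b) = π-3412 (n<1+n 0) 1<p₀ p₀<p₁ p₁<n
                                 (<-by πp₀≡0 πp₁≡1 (n<1+n 0)) (<-by πp₁≡1 π0≡a 1<a) (<-by π0≡a π1≡b a<b)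

    -- If π(1) = 0, compare c = π(a) with a.  For c > a the square has the
    -- 321  π²(0) π²(1) π²(p₁) = c a 0.  For c < a look at d = π(2): d > a
    -- gives the 3412  a d 1 2  in π, 1 < d < a the 321  a d 1  in π, and
    -- d = 1 the 3412  π²(0) π²(1) π²(2) π²(p₂) = c a 0 1  in π².
    firstLarge-secondZero : ∀ {p₁ p₂} → π 1 ≡ 0 → π p₁ ≡ 1 → π p₂ ≡ 2 → p₁ < n → p₂ < n → ⊥
    firstLarge-secondZero {p₁} {p₂} π1≡0 πp₁≡1 πp₂≡2 p₁<n p₂<n = compareImage (<-cmp (π a) a)
      where
      1<p₁ = >1 (positions-differ πp₁≡1 π0≡a (<⇒≢ 1<a)) (positions-differ πp₁≡1 π1≡0 (λ ()))
      p₁<p₂ = belowFirstIncreasing π0≡a (n<1+n 1) 2<a πp₁≡1 πp₂≡2 p₁<n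
      compareSecond : π a < a → Tri (π 2 < a) (π 2 ≡ a) (a < π 2) → ⊥
      compareSecond πa<a (tri> _ _ a<d) = π-3412 z<s 2<p₁ p₁<p₂ p₂<n
                                            (<-by πp₁≡1 πp₂≡2 (n<1+n 1)) (<-by πp₂≡2 π0≡a 2<a)
                                            (<-by π0≡a refl a<d)
        where
        2<p₁ = ≤∧≢⇒< 1<p₁ (positions-differ refl πp₁≡1 (<⇒≢ (<-trans 1<a a<d) ∘ sym))
      compareSecond πa<a (tri≈ _ d≡a _) = 1+n≢0 (injective 2<n 0<n (trans d≡a (sym π0≡a)))
      compareSecond πa<a (tri< d<a _ _) with π 2 ≟ 1
      ... | no d≢1 = π-321 z<s 2<p₁ p₁<n (<-by πp₁≡1 refl 1<d) (<-by refl π0≡a d<a)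
        where
        1<d = >1 (λ d≡0 → 1+n≢0 (suc-injective (injective 2<n 1<n (trans d≡0 (sym π1≡0))))) d≢1
        2<p₁ = ≤∧≢⇒< 1<p₁ (positions-differ refl πp₁≡1 d≢1)
      ... | yes d≡1 = π²-3412 (n<1+n 0) (n<1+n 1) 2<p₂ p₂<n
                        (<-by (squared d≡1 π1≡0) (squared πp₂≡2 d≡1) (n<1+n 0))
                        (<-by (squared πp₂≡2 d≡1) (squared π0≡a refl) 1<πa)
                        (<-by (squared π0≡a refl) (squared π1≡0 π0≡a) πa<a)
        where
        2<p₂ = subst (_< p₂) (injective p₁<n 2<n (trans πp₁≡1 (sym d≡1))) p₁<p₂
        1<πa = >1 (λ πa≡0 → <⇒≢ 1<a (sym (injective a<n 1<n (trans πa≡0 (sym π1≡0)))))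
                  (λ πa≡1 → <⇒≢ 2<a (sym (injective a<n 2<n (trans πa≡1 (sym d≡1)))))
      compareImage : Tri (π a < a) (π a ≡ a) (a < π a) → ⊥
      compareImage (tri< πa<a _ _) = compareSecond πa<a (<-cmp (π 2) a)
      compareImage (tri≈ _ πa≡a _) = <⇒≢ 0<a (sym (injective a<n 0<n (trans πa≡a (sym π0≡a))))
      compareImage (tri> _ _ a<πa) = π²-321 (n<1+n 0) 1<p₁ p₁<n
                                       (<-by (squared πp₁≡1 π1≡0) (squared π1≡0 π0≡a) 0<a)
                                       (<-by (squared π1≡0 π0≡a) (squared π0≡a refl) a<πa)

    firstEntry<3 : ⊥
    firstEntry<3 with preimage 0<n | preimage 1<n | preimage 2<n | π 1 ≟ 0
    ... | p₀ , p₀<n , πp₀≡0 | p₁ , p₁<n , πp₁≡1 | _ | no π1≢0 =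
      firstLarge-secondNonzero refl π1≢0 πp₀≡0 πp₁≡1 p₀<n p₁<n
    ... | _ | p₁ , p₁<n , πp₁≡1 | p₂ , p₂<n , πp₂≡2 | yes π1≡0 =
      firstLarge-secondZero π1≡0 πp₁≡1 πp₂≡2 p₁<n p₂<n

  -- Claim 2: the value 0 sits at a position j ≤ 2.  Otherwise
  -- π(0) < π(1) < π(2) by beforeZeroIncreasing, and π(0) ∈ {1, 2} by Claim 1.
  module _ {j : ℕ} (πj≡0 : π j ≡ 0) (j<n : j < n) (3≤j : 3 ≤ j) where
    private
      2<j = 3≤j
      1<j = <-trans (n<1+n 1) 2<j
      0<j = <-trans (n<1+n 0) 1<j
      2<n = <-trans 2<j j<n
      1<n = <-trans 1<j j<n
      π0<π1 = beforeZeroIncreasing πj≡0 (n<1+n 0) 1<j j<n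
      π1<π2 = beforeZeroIncreasing πj≡0 (n<1+n 1) 2<j j<n

    -- π(0) = 2: with m the position of 1, either π(0) 1 0 is a 321 (m < j)
    -- or π(0) π(1) 0 1 is a 3412 (m > j).
    zeroLate-first2 : ∀ {m} → π 0 ≡ 2 → π m ≡ 1 → m < n → ⊥
    zeroLate-first2 {m} π0≡2 πm≡1 m<n with <-cmp m j
    ... | tri< m<j _ _ = π-321 0<m m<j j<n (<-by πj≡0 πm≡1 z<s) (<-by πm≡1 π0≡2 (n<1+n 1))
      where 0<m = n≢0⇒n>0 (positions-differ πm≡1 π0≡2 (λ ()))
    ... | tri≈ _ m≡j _ = 1+n≢0 (trans (sym πm≡1) (trans (cong π m≡j) πj≡0))
    ... | tri> _ _ j<m = π-3412 (n<1+n 0) 1<j j<m m<n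
                           (<-by πj≡0 πm≡1 z<s) (<-by πm≡1 π0≡2 (n<1+n 1)) π0<π1

    -- π(0) = 1: the value 2 sits at position 1; otherwise  π(1) π(2) 0 2  is a
    -- 3412 (2 after 0) or  π(2) 2 0  is a 321 (2 before 0 at a position ≥ 3).
    zeroLate-first1-second2 : ∀ {l} → π 0 ≡ 1 → π l ≡ 2 → l < n → π 1 ≡ 2
    zeroLate-first1-second2 {l} π0≡1 πl≡2 l<n with <-cmp l j
    ... | tri> _ _ j<l = ⊥-elim (π-3412 (n<1+n 1) 2<j j<l l<n (<-by πj≡0 πl≡2 z<s) (<-by πl≡2 refl 2<π1) π1<π2)
      where
      2<π1 = ≤∧≢⇒< (subst (_< π 1) π0≡1 π0<π1)
               (λ 2≡π1 → <⇒≢ (<-trans 1<j j<l) (injective 1<n l<n (trans (sym 2≡π1) (sym πl≡2))))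
    ... | tri≈ _ l≡j _ = ⊥-elim (1+n≢0 (trans (sym πl≡2) (trans (cong π l≡j) πj≡0)))
    ... | tri< l<j _ _ with l ≟ 1
    ...   | yes l≡1 = trans (cong π (sym l≡1)) πl≡2
    ...   | no l≢1 = ⊥-elim (π-321 (>2 l≢0 l≢1 l≢2) l<j j<n (<-by πj≡0 πl≡2 z<s) (<-by πl≡2 refl 2<π2))
      where
      2<π2 = ≤-<-trans (subst (_< π 1) π0≡1 π0<π1) π1<π2
      l≢0 = positions-differ πl≡2 π0≡1 (λ ())
      l≢2 = positions-differ πl≡2 refl (<⇒≢ 2<π2)

    -- π(0) = 1, π(1) = 2: with x the position of the value j, the square has
    -- the 321  π²(0) π²(j) π²(x) = 2 1 0  (x > j) or the 3412
    -- π²(0) π²(1) π²(x) π²(j) = 2 π(2) 0 1  (x < j).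
    zeroLate-first1 : ∀ {x} → π 0 ≡ 1 → π 1 ≡ 2 → π x ≡ j → x < n → ⊥
    zeroLate-first1 {x} π0≡1 π1≡2 πx≡j x<n with <-cmp x j
    ... | tri> _ _ j<x = π²-321 0<j j<x x<n
                           (<-by (squared πx≡j πj≡0) (squared πj≡0 π0≡1) z<s)
                           (<-by (squared πj≡0 π0≡1) (squared π0≡1 π1≡2) (n<1+n 1))
    ... | tri≈ _ x≡j _ = <⇒≢ 0<j (trans (sym πj≡0) (trans (cong π (sym x≡j)) πx≡j))
    ... | tri< x<j _ _ = π²-3412 (n<1+n 0) 1<x x<j j<n
                           (<-by (squared πx≡j πj≡0) (squared πj≡0 π0≡1) z<s)
                           (<-by (squared πj≡0 π0≡1) (squared π0≡1 π1≡2) (n<1+n 1))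
                           (<-by (squared π0≡1 π1≡2) (squared π1≡2 refl) (subst (_< π 2) π1≡2 π1<π2))
      where
      1<x = >1 (positions-differ πx≡j π0≡1 (<⇒≢ 1<j ∘ sym)) (positions-differ πx≡j π1≡2 (<⇒≢ 2<j ∘ sym))

    zeroPosition<3 : ⊥
    zeroPosition<3 with π 0 in π0≡a
    ... | 0 = <⇒≢ 0<j (injective 0<n j<n (trans π0≡a (sym πj≡0)))
    ... | 1 = let l , l<n , πl≡2 = preimage 2<n
                  x , x<n , πx≡j = preimage j<n
              in zeroLate-first1 π0≡a (zeroLate-first1-second2 π0≡a πl≡2 l<n) πx≡j x<n
    ... | 2 = let m , m<n , πm≡1 = preimage 1<n in zeroLate-first2 π0≡a πm≡1 m<n
    ... | suc (suc (suc a)) = firstEntry<3 π0≡a (three≤ a)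

  zeroAt1or2 : π 0 ≢ 0 → π 1 ≡ 0 ⊎ (π 2 ≡ 0 × 2 < n)
  zeroAt1or2 π0≢0 with preimage 0<n
  ... | j , j<n , πj≡0 with j ≟ 1 | j ≟ 2
  ...   | yes refl | _ = inj₁ πj≡0
  ...   | no _ | yes refl = inj₂ (πj≡0 , j<n)
  ...   | no j≢1 | no j≢2 = ⊥-elim (zeroPosition<3 πj≡0 j<n (>2 j≢0 j≢1 j≢2))
    where j≢0 = positions-differ πj≡0 refl (π0≢0 ∘ sym)

  -- π(0) = 1, π(1) = b ≥ 3, π(2) = 0: with l the position of 2, the square
  -- has the 321  π²(0) π²(2) π²(l) = b 1 0.
  first1-second≥3 : ∀ {b l} → π 0 ≡ 1 → π 1 ≡ b → 3 ≤ b → π 2 ≡ 0 → π l ≡ 2 → l < n → ⊥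
  first1-second≥3 π0≡1 π1≡b 3≤b π2≡0 πl≡2 l<n =
    π²-321 z<s 2<l l<n (<-by (squared πl≡2 π2≡0) (squared π2≡0 π0≡1) z<s)
                       (<-by (squared π2≡0 π0≡1) (squared π0≡1 π1≡b) (<-trans (n<1+n 1) 3≤b))
    where
    2<l = >2 (positions-differ πl≡2 π0≡1 (λ ())) (positions-differ πl≡2 π1≡b (<⇒≢ 3≤b))
             (positions-differ πl≡2 π2≡0 (λ ()))

  -- π(0) = 2, π(1) = 0, π(2) = c ≥ 3: with m the position of 1, the square
  -- has the 321  π²(0) π²(1) π²(m) = c 2 0.
  first2-third≥3 : ∀ {c m} → π 0 ≡ 2 → π 1 ≡ 0 → π 2 ≡ c → 3 ≤ c → π m ≡ 1 → m < n → ⊥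
  first2-third≥3 π0≡2 π1≡0 π2≡c 3≤c πm≡1 m<n =
    π²-321 z<s 1<m m<n (<-by (squared πm≡1 π1≡0) (squared π1≡0 π0≡2) z<s)
                       (<-by (squared π1≡0 π0≡2) (squared π0≡2 π2≡c) 3≤c)
    where
    1<m = <-trans (n<1+n 1) (>2 (positions-differ πm≡1 π0≡2 (λ ())) (positions-differ πm≡1 π1≡0 (λ ()))
                                (positions-differ πm≡1 π2≡c (<⇒≢ (<-trans (n<1+n 1) 3≤c))))

  -- π(0) = 2, π(2) = 0, π(1) = b ≥ 3: with m the position of 1,
  -- π(0) π(1) π(2) π(m) = 2 b 0 1 is a 3412 in π.
  first2-second≥3 : ∀ {b m} → π 0 ≡ 2 → π 1 ≡ b → 3 ≤ b → π 2 ≡ 0 → π m ≡ 1 → m < n → ⊥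
  first2-second≥3 π0≡2 π1≡b 3≤b π2≡0 πm≡1 m<n =
    π-3412 z<s (n<1+n 1) 2<m m<n (<-by π2≡0 πm≡1 z<s) (<-by πm≡1 π0≡2 (n<1+n 1)) (<-by π0≡2 π1≡b 3≤b)
    where
    2<m = >2 (positions-differ πm≡1 π0≡2 (λ ())) (positions-differ πm≡1 π1≡b (<⇒≢ (<-trans (n<1+n 1) 3≤b)))
             (positions-differ πm≡1 π2≡0 (λ ()))

  startingWith1 : π 0 ≡ 1 → FirstBlock π
  startingWith1 π0≡1 with zeroAt1or2 (λ π0≡0 → 1+n≢0 (trans (sym π0≡1) π0≡0))
  ... | inj₁ π1≡0 = inj₂ (inj₁ (π0≡1 , π1≡0))
  ... | inj₂ (π2≡0 , 2<n) with π 1 in π1≡b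
  ...   | 0 = ⊥-elim (1+n≢0 (suc-injective (injective 2<n (<-trans (n<1+n 1) 2<n) (trans π2≡0 (sym π1≡b)))))
  ...   | 1 = ⊥-elim (1+n≢0 (injective (<-trans (n<1+n 1) 2<n) 0<n (trans π1≡b (sym π0≡1))))
  ...   | 2 = inj₂ (inj₂ (inj₁ (π0≡1 , refl , π2≡0)))
  ...   | suc (suc (suc b)) = let l , l<n , πl≡2 = preimage 2<n
                              in ⊥-elim (first1-second≥3 π0≡1 π1≡b (three≤ b) π2≡0 πl≡2 l<n)

  module _ (π0≡2 : π 0 ≡ 2) {m : ℕ} (πm≡1 : π m ≡ 1) (m<n : m < n) where
    private
      2<n = value<size H 0<n π0≡2
      1<n = <-trans (n<1+n 1) 2<n

    startingWith2 : FirstBlock π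
    startingWith2 with zeroAt1or2 (λ π0≡0 → 1+n≢0 (trans (sym π0≡2) π0≡0))
    ... | inj₁ π1≡0 with π 2 in π2≡c
    ...   | 0 = ⊥-elim (1+n≢0 (suc-injective (injective 2<n 1<n (trans π2≡c (sym π1≡0)))))
    ...   | 1 = inj₂ (inj₂ (inj₂ (π0≡2 , π1≡0 , refl)))
    ...   | 2 = ⊥-elim (1+n≢0 (injective 2<n 0<n (trans π2≡c (sym π0≡2))))
    ...   | suc (suc (suc c)) = ⊥-elim (first2-third≥3 π0≡2 π1≡0 π2≡c (three≤ c) πm≡1 m<n)
    startingWith2 | inj₂ (π2≡0 , _) with π 1 in π1≡b
    ...   | 0 = ⊥-elim (1+n≢0 (suc-injective (injective 2<n 1<n (trans π2≡0 (sym π1≡b)))))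
    ...   | 1 = ⊥-elim (π-321 z<s (n<1+n 1) 2<n (<-by π2≡0 π1≡b z<s) (<-by π1≡b π0≡2 (n<1+n 1)))
    ...   | 2 = ⊥-elim (1+n≢0 (injective 1<n 0<n (trans π1≡b (sym π0≡2))))
    ...   | suc (suc (suc b)) = ⊥-elim (first2-second≥3 π0≡2 π1≡b (three≤ b) π2≡0 πm≡1 m<n)

  firstBlock : FirstBlock π
  firstBlock = byFirstEntry (π 0) refl
    where
    byFirstEntry : ∀ a → π 0 ≡ a → FirstBlock π
    byFirstEntry 0 π0≡0 = inj₁ π0≡0
    byFirstEntry 1 π0≡1 = startingWith1 π0≡1
    byFirstEntry 2 π0≡2 = let m , m<n , πm≡1 = preimage (<-trans (n<1+n 1) (value<size H 0<n π0≡2))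
                          in startingWith2 π0≡2 πm≡1 m<n
    byFirstEntry (suc (suc (suc a))) π0≡a = ⊥-elim (firstEntry<3 π0≡a (three≤ a))

∸-reflects-< : ∀ {x y} k → x ∸ k < y ∸ k → x < y
∸-reflects-< {x} {y} k x∸k<y∸k with <-cmp x y
... | tri< x<y _ _ = x<y
... | tri≈ _ refl _ = ⊥-elim (<-irrefl refl x∸k<y∸k)
... | tri> _ _ y<x = ⊥-elim (<⇒≱ x∸k<y∸k (∸-monoˡ-≤ k (<⇒≤ y<x)))

-- Avoidance passes to g x = f (k + x) − k: the positions and values of an
-- occurrence in g, shifted by k, form an occurrence in f.
restrict-321 : ∀ {f g : ℕ → ℕ} k {m} → (∀ {x} → x < m → g x ≡ f (k + x) ∸ k) →
               Avoids321 f (k + m) → Avoids321 g m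
restrict-321 {f} {g} k {m} g≡ av {i} {j} {l} i<j j<l l<m gl<gj gj<gi =
  av (+-monoʳ-< k i<j) (+-monoʳ-< k j<l) (+-monoʳ-< k l<m)
     (∸-reflects-< k (subst₂ _<_ (g≡ l<m) (g≡ j<m) gl<gj))
     (∸-reflects-< k (subst₂ _<_ (g≡ j<m) (g≡ (<-trans i<j j<m)) gj<gi))
  where j<m = <-trans j<l l<m

restrict-3412 : ∀ {f g : ℕ → ℕ} k {m} → (∀ {x} → x < m → g x ≡ f (k + x) ∸ k) →
                Avoids3412 f (k + m) → Avoids3412 g m
restrict-3412 {f} {g} k {m} g≡ av {i} {j} {l} {o} i<j j<l l<o o<m gl<go go<gi gi<gj =
  av (+-monoʳ-< k i<j) (+-monoʳ-< k j<l) (+-monoʳ-< k l<o) (+-monoʳ-< k o<m)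
     (∸-reflects-< k (subst₂ _<_ (g≡ l<m) (g≡ o<m) gl<go))
     (∸-reflects-< k (subst₂ _<_ (g≡ o<m) (g≡ i<m) go<gi))
     (∸-reflects-< k (subst₂ _<_ (g≡ i<m) (g≡ j<m) gi<gj))
  where
  l<m = <-trans l<o o<m
  j<m = <-trans j<l l<m
  i<m = <-trans i<j j<m

record PermutesPrefix (π : ℕ → ℕ) (k : ℕ) : Set where
  field
    stays : ∀ {i} → i < k → π i < k
    hits  : ∀ {v} → v < k → ∃[ i ] i < k × π i ≡ v

module Peel {π : ℕ → ℕ} {k m : ℕ} (H : SAvPerm π (k + m)) (P : PermutesPrefix π k) where
  open SAvPerm H
  open PermutesPrefix P

  -- Past the prefix, π takes values ≥ k (those below k are used up).
  tail-large : ∀ {x} → x < m → k ≤ π (k + x)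
  tail-large {x} x<m with <-cmp (π (k + x)) k
  ... | tri≈ _ eq _ = ≤-reflexive (sym eq)
  ... | tri> _ _ k<πkx = <⇒≤ k<πkx
  ... | tri< πkx<k _ _ =
    let i , i<k , πi≡ = hits πkx<k
    in ⊥-elim (<⇒≱ (subst (_< k) (injective (<-≤-trans i<k (m≤m+n k m)) (+-monoʳ-< k x<m) πi≡) i<k) (m≤m+n k x))

  tail-into : ∀ {x} → x < m → π (k + x) ∸ k < m
  tail-into {x} x<m = subst (π (k + x) ∸ k <_) (m+n∸m≡n k m) (∸-monoˡ-< (into (+-monoʳ-< k x<m)) (tail-large x<m))

  module _ (g : ℕ → ℕ) (g≡ : ∀ {x} → x < m → g x ≡ π (k + x) ∸ k) where

    private
      g-into : ∀ {x} → x < m → g x < m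
      g-into x<m = subst (_< m) (sym (g≡ x<m)) (tail-into x<m)

      -- The square of g is the restriction of π², since π(k + x) ≥ k.
      g²≡ : ∀ {x} → x < m → g (g x) ≡ π (π (k + x)) ∸ k
      g²≡ {x} x<m = begin
        g (g x)                      ≡⟨ g≡ (g-into x<m) ⟩
        π (k + g x) ∸ k              ≡⟨ cong (λ y → π (k + y) ∸ k) (g≡ x<m) ⟩
        π (k + (π (k + x) ∸ k)) ∸ k  ≡⟨ cong (λ y → π y ∸ k) (m+[n∸m]≡n (tail-large x<m)) ⟩
        π (π (k + x)) ∸ k            ∎
        where open ≡-Reasoning

      -- Surjectivity: the preimage y of k + v lies past the prefix, which is
      -- mapped below k.
      g-preimage : ∀ {v} → v < m → ∃[ x ] x < m × g x ≡ v
      g-preimage {v} v<m with preimage (+-monoʳ-< k v<m)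
      ... | y , y<k+m , πy≡k+v = y ∸ k , y∸k<m , g[y∸k]≡v
        where
        k≤y : k ≤ y
        k≤y with <-cmp y k
        ... | tri< y<k _ _ = ⊥-elim (<⇒≱ (stays y<k) (subst (k ≤_) (sym πy≡k+v) (m≤m+n k v)))
        ... | tri≈ _ y≡k _ = ≤-reflexive (sym y≡k)
        ... | tri> _ _ k<y = <⇒≤ k<y
        k+[y∸k]≡y = m+[n∸m]≡n k≤y
        y∸k<m = +-cancelˡ-< k (y ∸ k) m (subst (_< k + m) (sym k+[y∸k]≡y) y<k+m)
        g[y∸k]≡v = begin
          g (y ∸ k)                ≡⟨ g≡ y∸k<m ⟩
          π (k + (y ∸ k)) ∸ k      ≡⟨ cong (λ z → π z ∸ k) k+[y∸k]≡y ⟩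
          π y ∸ k                  ≡⟨ cong (_∸ k) πy≡k+v ⟩
          k + v ∸ k                ≡⟨ m+n∸m≡n k v ⟩
          v                        ∎
          where open ≡-Reasoning

    peel : SAvPerm g m
    peel = record
      { into = g-into
      ; injective = λ {x} {y} x<m y<m gx≡gy →
          +-cancelˡ-≡ k x y (injective (+-monoʳ-< k x<m) (+-monoʳ-< k y<m)
            (∸-cancelʳ-≡ (tail-large x<m) (tail-large y<m) (trans (sym (g≡ x<m)) (trans gx≡gy (g≡ y<m)))))
      ; preimage = g-preimage
      ; π-321 = restrict-321 k g≡ π-321
      ; π-3412 = restrict-3412 k g≡ π-3412
      ; π²-321 = restrict-321 k g²≡ π²-321
      ; π²-3412 = restrict-3412 k g²≡ π²-3412
      }

glue : ℕ → List ℕ → List ℕ → List ℕ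
glue k b ys = b ++ map (k +_) ys

-- blockWords n: the words of length n that are concatenations of the blocks
-- 0, 10, 120, 201 (each raised past the letters before it).
-- longStart n: those of length n + 1 whose first block has length ≥ 2;
-- start3 n: those of length n + 2 whose first block has length 3.
blockWords longStart start3 : ℕ → List (List ℕ)
blockWords zero = [] ∷ []
blockWords (suc n) = map (glue 1 (0 ∷ [])) (blockWords n) ++ longStart n
longStart zero = []
longStart (suc n) = map (glue 2 (1 ∷ 0 ∷ [])) (blockWords n) ++ start3 n
start3 zero = []
start3 (suc n) = map (glue 3 (1 ∷ 2 ∷ 0 ∷ [])) (blockWords n) ++ map (glue 3 (2 ∷ 0 ∷ 1 ∷ [])) (blockWords n)

length-map-++ : ∀ {A B : Set} (f : A → B) xs (ys : List B) → length (map f xs ++ ys) ≡ length xs + length ys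
length-map-++ f xs ys = trans (length-++ (map f xs)) (cong (_+ length ys) (length-map f xs))

length-start3 : ∀ n → length (start3 (suc n)) ≡ 2 * length (blockWords n)
length-start3 n = begin
  length (start3 (suc n))                        ≡⟨ length-map-++ _ (blockWords n) _ ⟩
  length (blockWords n) + length (map _ (blockWords n))
                                                 ≡⟨ cong (length (blockWords n) +_) (length-map _ (blockWords n)) ⟩
  length (blockWords n) + length (blockWords n)  ≡⟨ cong (length (blockWords n) +_) (sym (+-identityʳ _)) ⟩
  2 * length (blockWords n)                      ∎
  where open ≡-Reasoning

-- The counting recurrence: the first block has length 1, 2 or 3.
length-blockWords : ∀ n → length (blockWords n) ≡ coeff n
length-blockWords 0 = refl
length-blockWords 1 = refl
length-blockWords 2 = refl
length-blockWords (suc (suc (suc n))) = begin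
  length (blockWords (3 + n))                        ≡⟨ length-map-++ _ (blockWords (2 + n)) _ ⟩
  w (2 + n) + length (longStart (2 + n))             ≡⟨ cong (w (2 + n) +_) (length-map-++ _ (blockWords (1 + n)) _) ⟩
  w (2 + n) + (w (1 + n) + length (start3 (1 + n)))  ≡⟨ cong (λ l → w (2 + n) + (w (1 + n) + l)) (length-start3 n) ⟩
  w (2 + n) + (w (1 + n) + 2 * w n)                  ≡⟨ sym (+-assoc (w (2 + n)) (w (1 + n)) _) ⟩
  w (2 + n) + w (1 + n) + 2 * w n                    ≡⟨ cong₂ _+_ (cong₂ _+_ (length-blockWords (suc (suc n)))
                                                                            (length-blockWords (suc n)))
                                                                  (cong (2 *_) (length-blockWords n)) ⟩
  coeff (3 + n)                                      ∎
  where
  open ≡-Reasoning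
  w : ℕ → ℕ
  w m = length (blockWords m)

glue-injective : ∀ k b {ys ys'} → glue k b ys ≡ glue k b ys' → ys ≡ ys'
glue-injective k b {ys} {ys'} eq = map-injective (λ {x} {y} → +-cancelˡ-≡ k x y) (++-cancelˡ b _ _ eq)

∈-block1 : ∀ m {ys} → ys ∈ blockWords m → glue 1 (0 ∷ []) ys ∈ blockWords (suc m)
∈-block1 m ys∈ = ∈-++⁺ˡ (∈-map⁺ _ ys∈)

∈-block10 : ∀ m {ys} → ys ∈ blockWords m → glue 2 (1 ∷ 0 ∷ []) ys ∈ blockWords (2 + m)
∈-block10 m ys∈ = ∈-++⁺ʳ (map _ (blockWords (suc m))) (∈-++⁺ˡ (∈-map⁺ _ ys∈))

∈-block120 : ∀ m {ys} → ys ∈ blockWords m → glue 3 (1 ∷ 2 ∷ 0 ∷ []) ys ∈ blockWords (3 + m)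
∈-block120 m ys∈ = ∈-++⁺ʳ (map _ (blockWords (2 + m))) (∈-++⁺ʳ (map _ (blockWords (suc m)))
                     (∈-++⁺ˡ (∈-map⁺ _ ys∈)))

∈-block201 : ∀ m {ys} → ys ∈ blockWords m → glue 3 (2 ∷ 0 ∷ 1 ∷ []) ys ∈ blockWords (3 + m)
∈-block201 m ys∈ = ∈-++⁺ʳ (map _ (blockWords (2 + m))) (∈-++⁺ʳ (map _ (blockWords (suc m)))
                       (∈-++⁺ʳ (map _ (blockWords m)) (∈-map⁺ _ ys∈)))

-- The first block of a word, numbered 0, 1, 2, 3 for 0, 10, 120, 201; the
-- four parts of the definition of blockWords are told apart by it.
firstBlockCode : List ℕ → ℕ
firstBlockCode (0 ∷ _) = 0
firstBlockCode (1 ∷ 0 ∷ _) = 1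
firstBlockCode (1 ∷ 2 ∷ _) = 2
firstBlockCode (2 ∷ _) = 3
firstBlockCode _ = 4

code-longStart : ∀ n {xs} → xs ∈ longStart n → 1 ≤ firstBlockCode xs
code-start3 : ∀ n {xs} → xs ∈ start3 n → 2 ≤ firstBlockCode xs
code-longStart (suc n) xs∈ with ∈-++⁻ (map (glue 2 (1 ∷ 0 ∷ [])) (blockWords n)) xs∈
... | inj₁ first with ∈-map⁻ _ first
...   | _ , _ , refl = ≤-refl
code-longStart (suc n) xs∈ | inj₂ later = ≤-trans (n≤1+n 1) (code-start3 n later)
code-start3 (suc n) xs∈ with ∈-++⁻ (map (glue 3 (1 ∷ 2 ∷ 0 ∷ [])) (blockWords n)) xs∈
... | inj₁ first with ∈-map⁻ _ first
...   | _ , _ , refl = ≤-refl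
code-start3 (suc n) xs∈ | inj₂ later with ∈-map⁻ _ later
...   | _ , _ , refl = n≤1+n 2

separated : ∀ {xss yss : List (List ℕ)} c → (∀ {xs} → xs ∈ xss → firstBlockCode xs < c) →
            (∀ {ys} → ys ∈ yss → c ≤ firstBlockCode ys) → ∀ {zs} → ¬ (zs ∈ xss × zs ∈ yss)
separated c below above (zs∈xss , zs∈yss) = <⇒≱ (below zs∈xss) (above zs∈yss)

code-glued : ∀ {k b c yss xs} → (∀ ys → firstBlockCode (glue k b ys) ≡ c) →
             xs ∈ map (glue k b) yss → firstBlockCode xs ≡ c
code-glued code xs∈ with ∈-map⁻ _ xs∈
... | ys , _ , refl = code ys

unique-blockWords : ∀ n → Unique (blockWords n)
unique-longStart : ∀ n → Unique (longStart n)
unique-start3 : ∀ n → Unique (start3 n)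
unique-blockWords zero = [] ∷ []
unique-blockWords (suc n) =
  Unique.++⁺ (Unique.map⁺ (glue-injective 1 _) (unique-blockWords n)) (unique-longStart n)
    (separated 1 (λ xs∈ → ≤-reflexive (cong suc (code-glued (λ _ → refl) xs∈))) (code-longStart n))
unique-longStart zero = []
unique-longStart (suc n) =
  Unique.++⁺ (Unique.map⁺ (glue-injective 2 _) (unique-blockWords n)) (unique-start3 n)
    (separated 2 (λ xs∈ → ≤-reflexive (cong suc (code-glued (λ _ → refl) xs∈))) (code-start3 n))
unique-start3 zero = []
unique-start3 (suc n) =
  Unique.++⁺ (Unique.map⁺ (glue-injective 3 _) (unique-blockWords n))
             (Unique.map⁺ (glue-injective 3 _) (unique-blockWords n))
    (separated 3 (λ xs∈ → ≤-reflexive (cong suc (code-glued (λ _ → refl) xs∈)))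
                (λ xs∈ → ≤-reflexive (sym (code-glued (λ _ → refl) xs∈))))

Avoids : List ℕ → Set
Avoids xs = ¬ Has321 xs × ¬ Has3412 xs

record SAvWord (xs : List ℕ) (n : ℕ) : Set where
  field
    length≡             : length xs ≡ n
    bounded             : All (_< n) xs
    unique              : Unique xs
    pattern-free        : Avoids xs
    square-pattern-free : Avoids (squareL xs)

⊆-++⁻ : ∀ {A : Set} {s : List A} xs ys → s ⊆ xs ++ ys →
        ∃[ s₁ ] ∃[ s₂ ] s ≡ s₁ ++ s₂ × s₁ ⊆ xs × s₂ ⊆ ys
⊆-++⁻ [] ys sub = [] , _ , refl , [] , sub
⊆-++⁻ (x ∷ xs) ys (.x ∷ʳ sub) with ⊆-++⁻ xs ys sub
... | s₁ , s₂ , refl , sub₁ , sub₂ = s₁ , s₂ , refl , x ∷ʳ sub₁ , sub₂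
⊆-++⁻ (x ∷ xs) ys (refl ∷ sub) with ⊆-++⁻ xs ys sub
... | s₁ , s₂ , refl , sub₁ , sub₂ = x ∷ s₁ , s₂ , refl , refl ∷ sub₁ , sub₂

⊆-map⁻ : ∀ {A B : Set} {s : List B} (f : A → B) xs → s ⊆ map f xs → ∃[ s' ] s ≡ map f s' × s' ⊆ xs
⊆-map⁻ f [] [] = [] , refl , []
⊆-map⁻ f (x ∷ xs) (.(f x) ∷ʳ sub) with ⊆-map⁻ f xs sub
... | s' , refl , sub' = s' , refl , x ∷ʳ sub'
⊆-map⁻ f (x ∷ xs) (refl ∷ sub) with ⊆-map⁻ f xs sub
... | s' , refl , sub' = x ∷ s' , refl , refl ∷ sub'

shifted-large : ∀ k ys → All (k ≤_) (map (k +_) ys)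
shifted-large k [] = []
shifted-large k (y ∷ ys) = m≤m+n k y ∷ shifted-large k ys

-- Avoidance is preserved under glue when b lies below k: an occurrence meeting
-- both parts would need an entry of the raised part below an earlier entry
-- of b, so it lies entirely in b or entirely in the raised copy of ys.
glue-avoids321 : ∀ k b ys → All (_< k) b → ¬ Has321 b → ¬ Has321 ys → ¬ Has321 (glue k b ys)
glue-avoids321 k b ys b<k no-b no-ys (x , y , z , sub , z<y , y<x) with ⊆-++⁻ b _ sub
... | [] , s₂ , refl , _ , sub₂ with ⊆-map⁻ (k +_) ys sub₂
...   | x' ∷ y' ∷ z' ∷ [] , refl , sub' =
        no-ys (x' , y' , z' , sub' , +-cancelˡ-< k z' y' z<y , +-cancelˡ-< k y' x' y<x)
glue-avoids321 k b ys b<k no-b no-ys (x , y , z , sub , z<y , y<x) | .x ∷ [] , s₂ , refl , sub₁ , sub₂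
  with All-resp-⊆ sub₁ b<k | All-resp-⊆ sub₂ (shifted-large k ys)
... | x<k ∷ [] | k≤y ∷ _ = <⇒≱ (<-trans y<x x<k) k≤y
glue-avoids321 k b ys b<k no-b no-ys (x , y , z , sub , z<y , y<x) | .x ∷ .y ∷ [] , s₂ , refl , sub₁ , sub₂
  with All-resp-⊆ sub₁ b<k | All-resp-⊆ sub₂ (shifted-large k ys)
... | _ ∷ y<k ∷ [] | k≤z ∷ _ = <⇒≱ (<-trans z<y y<k) k≤z
glue-avoids321 k b ys b<k no-b no-ys (x , y , z , sub , z<y , y<x) | .x ∷ .y ∷ .z ∷ [] , [] , refl , sub₁ , _ =
  no-b (x , y , z , sub₁ , z<y , y<x)

glue-avoids3412 : ∀ k b ys → All (_< k) b → ¬ Has3412 b → ¬ Has3412 ys → ¬ Has3412 (glue k b ys)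
glue-avoids3412 k b ys b<k no-b no-ys (x , y , z , w , sub , z<w , w<x , x<y) with ⊆-++⁻ b _ sub
... | [] , s₂ , refl , _ , sub₂ with ⊆-map⁻ (k +_) ys sub₂
...   | x' ∷ y' ∷ z' ∷ w' ∷ [] , refl , sub' =
        no-ys (x' , y' , z' , w' , sub' , +-cancelˡ-< k z' w' z<w , +-cancelˡ-< k w' x' w<x , +-cancelˡ-< k x' y' x<y)
glue-avoids3412 k b ys b<k no-b no-ys (x , y , z , w , sub , z<w , w<x , x<y) | .x ∷ [] , s₂ , refl , sub₁ , sub₂
  with All-resp-⊆ sub₁ b<k | All-resp-⊆ sub₂ (shifted-large k ys)
... | x<k ∷ [] | _ ∷ k≤z ∷ _ = <⇒≱ (<-trans (<-trans z<w w<x) x<k) k≤z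
glue-avoids3412 k b ys b<k no-b no-ys (x , y , z , w , sub , z<w , w<x , x<y) | .x ∷ .y ∷ [] , s₂ , refl , sub₁ , sub₂
  with All-resp-⊆ sub₁ b<k | All-resp-⊆ sub₂ (shifted-large k ys)
... | x<k ∷ _ | k≤z ∷ _ = <⇒≱ (<-trans (<-trans z<w w<x) x<k) k≤z
glue-avoids3412 k b ys b<k no-b no-ys (x , y , z , w , sub , z<w , w<x , x<y) | .x ∷ .y ∷ .z ∷ [] , s₂ , refl , sub₁ , sub₂
  with All-resp-⊆ sub₁ b<k | All-resp-⊆ sub₂ (shifted-large k ys)
... | x<k ∷ _ | k≤w ∷ _ = <⇒≱ (<-trans w<x x<k) k≤w
glue-avoids3412 k b ys b<k no-b no-ys (x , y , z , w , sub , z<w , w<x , x<y) | .x ∷ .y ∷ .z ∷ .w ∷ [] , [] , refl , sub₁ , _ =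
  no-b (x , y , z , w , sub₁ , z<w , w<x , x<y)

glue-avoids : ∀ k b ys → All (_< k) b → Avoids b → Avoids ys → Avoids (glue k b ys)
glue-avoids k b ys b<k (b-321 , b-3412) (ys-321 , ys-3412) =
  glue-avoids321 k b ys b<k b-321 ys-321 , glue-avoids3412 k b ys b<k b-3412 ys-3412

!-++ˡ : ∀ xs ys {i} → i < length xs → (xs ++ ys) ! i ≡ xs ! i
!-++ˡ (x ∷ xs) ys {zero} _ = refl
!-++ˡ (x ∷ xs) ys {suc i} (s≤s i<) = !-++ˡ xs ys i<

!-++ʳ : ∀ xs ys i → (xs ++ ys) ! (length xs + i) ≡ ys ! i
!-++ʳ [] ys i = refl
!-++ʳ (x ∷ xs) ys i = !-++ʳ xs ys i

!-map : ∀ (f : ℕ → ℕ) xs {i} → i < length xs → map f xs ! i ≡ f (xs ! i)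
!-map f (x ∷ xs) {zero} _ = refl
!-map f (x ∷ xs) {suc i} (s≤s i<) = !-map f xs i<

square-glue : ∀ b ys → All (_< length b) b → All (_< length ys) ys →
              squareL (glue (length b) b ys) ≡ glue (length b) (squareL b) (squareL ys)
square-glue b ys b-bounded ys-bounded = begin
  map at (b ++ raised)                  ≡⟨ map-++ at b raised ⟩
  map at b ++ map at raised             ≡⟨ cong₂ _++_ on-b on-raised ⟩
  squareL b ++ map (k +_) (squareL ys)  ∎
  where
  open ≡-Reasoning
  k = length b
  raised = map (k +_) ys
  at = (b ++ raised) !_
  on-b : map at b ≡ squareL b
  on-b = map-cong-local (All-map (!-++ˡ b raised) b-bounded)
  on-raised : map at raised ≡ map (k +_) (squareL ys)
  on-raised = begin
    map at (map (k +_) ys)        ≡⟨ sym (map-∘ ys) ⟩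
    map (λ y → at (k + y)) ys     ≡⟨ map-cong-local (All-map (λ {y} y< → trans (!-++ʳ b raised y) (!-map (k +_) ys y<))
                                                             ys-bounded) ⟩
    map (λ y → k + ys ! y) ys     ≡⟨ map-∘ ys ⟩
    map (k +_) (squareL ys)       ∎

!-∈ : ∀ xs {i} → i < length xs → xs ! i ∈ xs
!-∈ (x ∷ xs) {zero} _ = here refl
!-∈ (x ∷ xs) {suc i} (s≤s i<) = there (!-∈ xs i<)

square-bounded : ∀ {xs n} → length xs ≡ n → All (_< n) xs → All (_< n) (squareL xs)
square-bounded {xs} refl bounded = All.map⁺ (All-map (λ i< → lookup bounded (!-∈ xs i<)) bounded)

glue-SAvWord : ∀ {b ys m} → SAvWord b (length b) → SAvWord ys m → SAvWord (glue (length b) b ys) (length b + m)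
glue-SAvWord {b} {ys} {m} B Y = record
  { length≡ = trans (length-++ b) (cong (k +_) (trans (length-map (k +_) ys) (length≡ Y)))
  ; bounded = All.++⁺ (All-map (λ x< → <-≤-trans x< (m≤m+n k m)) (bounded B))
                      (All.map⁺ (All-map (+-monoʳ-< k) (bounded Y)))
  ; unique = Unique.++⁺ (unique B) (Unique.map⁺ (λ {x} {y} → +-cancelˡ-≡ k x y) (unique Y)) apart
  ; pattern-free = glue-avoids k b ys (bounded B) (pattern-free B) (pattern-free Y)
  ; square-pattern-free = subst Avoids (sym (square-glue b ys (bounded B) ys-bounded))
                 (glue-avoids k (squareL b) (squareL ys) (square-bounded refl (bounded B))
                              (square-pattern-free B) (square-pattern-free Y))
  }
  where
  open SAvWord
  k = length b
  ys-bounded : All (_< length ys) ys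
  ys-bounded = subst (λ n → All (_< n) ys) (sym (length≡ Y)) (bounded Y)
  apart : ∀ {v} → ¬ (v ∈ b × v ∈ map (k +_) ys)
  apart (v∈b , v∈raised) with ∈-map⁻ (k +_) v∈raised
  ... | y , _ , refl = <⇒≱ (lookup (bounded B) v∈b) (m≤m+n k y)

⊆-full : ∀ {s xs : List ℕ} → s ⊆ xs → length s ≡ length xs → s ≡ xs
⊆-full [] _ = refl
⊆-full (y ∷ʳ sub) len≡ = ⊥-elim (<-irrefl len≡ (s≤s (length-mono-≤ sub)))
⊆-full (refl ∷ sub) len≡ = cong (_ ∷_) (⊆-full sub (suc-injective len≡))

avoids-short : ∀ {xs} → length xs ≤ 2 → Avoids xs
avoids-short len≤2 = (λ (_ , _ , _ , sub , _) → <⇒≱ (s≤s (s≤s (s≤s z≤n))) (≤-trans (length-mono-≤ sub) len≤2))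
                   , (λ (_ , _ , _ , _ , sub , _) → <⇒≱ (s≤s (s≤s (s≤s z≤n))) (≤-trans (length-mono-≤ sub) len≤2))

avoids-3 : ∀ {a b c} → ¬ (c < b × b < a) → Avoids (a ∷ b ∷ c ∷ [])
avoids-3 {a} {b} {c} not-decreasing = no321 , no3412
  where
  no321 : ¬ Has321 (a ∷ b ∷ c ∷ [])
  no321 (_ , _ , _ , sub , c<b , b<a) with ⊆-full sub refl
  ... | refl = not-decreasing (c<b , b<a)
  no3412 : ¬ Has3412 (a ∷ b ∷ c ∷ [])
  no3412 (_ , _ , _ , _ , sub , _) = <⇒≱ ≤-refl (length-mono-≤ sub)

empty-SAvWord : SAvWord [] 0
empty-SAvWord = record { length≡ = refl ; bounded = [] ; unique = []
                       ; pattern-free = avoids-short z≤n ; square-pattern-free = avoids-short z≤n }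

-- The blocks 0, 10, 120, 201 have squares 0, 01, 201, 120.
block0 : SAvWord (0 ∷ []) 1
block0 = record { length≡ = refl ; bounded = z<s ∷ [] ; unique = [] ∷ []
                ; pattern-free = avoids-short (s≤s z≤n) ; square-pattern-free = avoids-short (s≤s z≤n) }

block10 : SAvWord (1 ∷ 0 ∷ []) 2
block10 = record { length≡ = refl ; bounded = n<1+n 1 ∷ z<s ∷ [] ; unique = ((λ ()) ∷ []) ∷ [] ∷ []
                 ; pattern-free = avoids-short ≤-refl ; square-pattern-free = avoids-short ≤-refl }

block120 : SAvWord (1 ∷ 2 ∷ 0 ∷ []) 3
block120 = record { length≡ = refl ; bounded = s≤s (s≤s z≤n) ∷ ≤-refl ∷ z<s ∷ []
                  ; unique = ((λ ()) ∷ (λ ()) ∷ []) ∷ ((λ ()) ∷ []) ∷ [] ∷ []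
                  ; pattern-free = avoids-3 (λ { (_ , s≤s ()) }) ; square-pattern-free = avoids-3 (λ { (() , _) }) }

block201 : SAvWord (2 ∷ 0 ∷ 1 ∷ []) 3
block201 = record { length≡ = refl ; bounded = ≤-refl ∷ z<s ∷ s≤s (s≤s z≤n) ∷ []
                  ; unique = ((λ ()) ∷ (λ ()) ∷ []) ∷ ((λ ()) ∷ []) ∷ [] ∷ []
                  ; pattern-free = avoids-3 (λ { (() , _) }) ; square-pattern-free = avoids-3 (λ { (_ , s≤s ()) }) }

blockWords-sound : ∀ n {xs} → xs ∈ blockWords n → SAvWord xs n
longStart-sound : ∀ n {xs} → xs ∈ longStart n → SAvWord xs (suc n)
start3-sound : ∀ n {xs} → xs ∈ start3 n → SAvWord xs (2 + n)

glued-sound : ∀ {b n xs} → SAvWord b (length b) → xs ∈ map (glue (length b) b) (blockWords n) →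
              SAvWord xs (length b + n)
glued-sound {n = n} B xs∈ with ∈-map⁻ _ xs∈
... | ys , ys∈ , refl = glue-SAvWord B (blockWords-sound n ys∈)

blockWords-sound zero (here refl) = empty-SAvWord
blockWords-sound (suc n) xs∈ with ∈-++⁻ (map (glue 1 (0 ∷ [])) (blockWords n)) xs∈
... | inj₁ first = glued-sound block0 first
... | inj₂ later = longStart-sound n later
longStart-sound (suc n) xs∈ with ∈-++⁻ (map (glue 2 (1 ∷ 0 ∷ [])) (blockWords n)) xs∈
... | inj₁ first = glued-sound block10 first
... | inj₂ later = start3-sound n later
start3-sound (suc n) xs∈ with ∈-++⁻ (map (glue 3 (1 ∷ 2 ∷ 0 ∷ [])) (blockWords n)) xs∈
... | inj₁ first = glued-sound block120 first
... | inj₂ later = glued-sound block201 later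

same-members-same-length : ∀ {A : Set} {xs ys : List A} → Unique xs → Unique ys →
                           (∀ {z} → z ∈ xs → z ∈ ys) → (∀ {z} → z ∈ ys → z ∈ xs) → length xs ≡ length ys
same-members-same-length xs-unique ys-unique to from =
  ↭-length (∼bag⇒↭ (unique∧set⇒bag xs-unique ys-unique (mk⇔ to from)))

pigeonhole : ∀ {xs n v} → Unique xs → All (_< n) xs → length xs ≡ n → v < n → v ∈ xs
pigeonhole {xs} {n} {v} xs-unique bounded refl v<n with v ∈? xs
... | yes v∈xs = v∈xs
... | no v∉xs = ⊥-elim (<-irrefl (sym same-length) (subst (length present <_) (length-upTo n) too-short))
  where
  present = filter (_∈? xs) (upTo n)
  same-length : length xs ≡ length present
  same-length = same-members-same-length xs-unique (Unique.filter⁺ (_∈? xs) (Unique.upTo⁺ n))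
    (λ x∈xs → ∈-filter⁺ (_∈? xs) (∈-upTo⁺ (lookup bounded x∈xs)) x∈xs)
    (λ x∈present → proj₂ (∈-filter⁻ (_∈? xs) {xs = upTo n} x∈present))
  too-short : length present < length (upTo n)
  too-short = filter-notAll (_∈? xs) (upTo n) (Any-map (λ { refl → v∉xs }) (∈-upTo⁺ v<n))

∈⇒index : ∀ {xs v} → v ∈ xs → ∃[ i ] i < length xs × xs ! i ≡ v
∈⇒index (here refl) = 0 , z<s , refl
∈⇒index (there v∈xs) = let i , i< , xs!i≡v = ∈⇒index v∈xs in suc i , s≤s i< , xs!i≡v

!-injective : ∀ {xs i j} → Unique xs → i < length xs → j < length xs → xs ! i ≡ xs ! j → i ≡ j
!-injective {x ∷ xs} {zero} {zero} _ _ _ _ = refl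
!-injective {x ∷ xs} {zero} {suc j} (x∉ ∷ _) _ (s≤s j<) x≡ = ⊥-elim (lookup x∉ (!-∈ xs j<) x≡)
!-injective {x ∷ xs} {suc i} {zero} (x∉ ∷ _) (s≤s i<) _ ≡x = ⊥-elim (lookup x∉ (!-∈ xs i<) (sym ≡x))
!-injective {x ∷ xs} {suc i} {suc j} (_ ∷ unique) (s≤s i<) (s≤s j<) eq = cong suc (!-injective unique i< j< eq)

⊆-at₁ : ∀ xs {i} → i < length xs → (xs ! i ∷ []) ⊆ xs
⊆-at₁ (x ∷ xs) {zero} _ = refl ∷ minimum xs
⊆-at₁ (x ∷ xs) {suc i} (s≤s i<) = x ∷ʳ ⊆-at₁ xs i<

⊆-at₂ : ∀ xs {i j} → i < j → j < length xs → (xs ! i ∷ xs ! j ∷ []) ⊆ xs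
⊆-at₂ (x ∷ xs) {zero} {suc j} _ (s≤s j<) = refl ∷ ⊆-at₁ xs j<
⊆-at₂ (x ∷ xs) {suc i} {suc j} (s≤s i<j) (s≤s j<) = x ∷ʳ ⊆-at₂ xs i<j j<

⊆-at₃ : ∀ xs {i j k} → i < j → j < k → k < length xs → (xs ! i ∷ xs ! j ∷ xs ! k ∷ []) ⊆ xs
⊆-at₃ (x ∷ xs) {zero} {suc j} {suc k} _ (s≤s j<k) (s≤s k<) = refl ∷ ⊆-at₂ xs j<k k<
⊆-at₃ (x ∷ xs) {suc i} {suc j} {suc k} (s≤s i<j) (s≤s j<k) (s≤s k<) = x ∷ʳ ⊆-at₃ xs i<j j<k k<

⊆-at₄ : ∀ xs {i j k l} → i < j → j < k → k < l → l < length xs →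
        (xs ! i ∷ xs ! j ∷ xs ! k ∷ xs ! l ∷ []) ⊆ xs
⊆-at₄ (x ∷ xs) {zero} {suc j} {suc k} {suc l} _ (s≤s j<k) (s≤s k<l) (s≤s l<) = refl ∷ ⊆-at₃ xs j<k k<l l<
⊆-at₄ (x ∷ xs) {suc i} {suc j} {suc k} {suc l} (s≤s i<j) (s≤s j<k) (s≤s k<l) (s≤s l<) =
  x ∷ʳ ⊆-at₄ xs i<j j<k k<l l<

avoids321-at : ∀ xs {f : ℕ → ℕ} {n} → length xs ≡ n → (∀ {i} → i < n → f i ≡ xs ! i) →
               ¬ Has321 xs → Avoids321 f n
avoids321-at xs refl f≡ no321 {i} {j} {k} i<j j<k k<n fk<fj fj<fi =
  no321 (_ , _ , _ , ⊆-at₃ xs i<j j<k k<n , subst₂ _<_ (f≡ k<n) (f≡ j<n) fk<fj , subst₂ _<_ (f≡ j<n) (f≡ i<n) fj<fi)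
  where
  j<n = <-trans j<k k<n
  i<n = <-trans i<j j<n

avoids3412-at : ∀ xs {f : ℕ → ℕ} {n} → length xs ≡ n → (∀ {i} → i < n → f i ≡ xs ! i) →
                ¬ Has3412 xs → Avoids3412 f n
avoids3412-at xs refl f≡ no3412 {i} {j} {k} {l} i<j j<k k<l l<n fk<fl fl<fi fi<fj =
  no3412 (_ , _ , _ , _ , ⊆-at₄ xs i<j j<k k<l l<n ,
          subst₂ _<_ (f≡ k<n) (f≡ l<n) fk<fl , subst₂ _<_ (f≡ l<n) (f≡ i<n) fl<fi ,
          subst₂ _<_ (f≡ i<n) (f≡ j<n) fi<fj)
  where
  k<n = <-trans k<l l<n
  j<n = <-trans j<k k<n
  i<n = <-trans i<j j<n

SAvWord⇒SAvPerm : ∀ {xs n} → SAvWord xs n → SAvPerm (xs !_) n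
SAvWord⇒SAvPerm {xs} {n} W = record
  { into = λ i<n → lookup bounded (!-∈ xs (<-len i<n))
  ; injective = λ i<n j<n → !-injective unique (<-len i<n) (<-len j<n)
  ; preimage = λ v<n → let i , i< , xs!i≡v = ∈⇒index (pigeonhole unique bounded length≡ v<n)
                       in i , subst (i <_) length≡ i< , xs!i≡v
  ; π-321 = avoids321-at xs length≡ (λ _ → refl) (proj₁ pattern-free)
  ; π-3412 = avoids3412-at xs length≡ (λ _ → refl) (proj₂ pattern-free)
  ; π²-321 = avoids321-at (squareL xs) sq-length (λ i<n → sym (!-map _ xs (<-len i<n))) (proj₁ square-pattern-free)
  ; π²-3412 = avoids3412-at (squareL xs) sq-length (λ i<n → sym (!-map _ xs (<-len i<n))) (proj₂ square-pattern-free)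
  }
  where
  open SAvWord W
  <-len : ∀ {i} → i < n → i < length xs
  <-len = subst (_ <_) (sym length≡)
  sq-length : length (squareL xs) ≡ n
  sq-length = trans (length-map _ xs) length≡

block-prefix : ∀ {b} → SAvWord b (length b) → ∀ rest → PermutesPrefix ((b ++ rest) !_) (length b)
block-prefix {b} B rest = record
  { stays = λ i< → subst (_< length b) (sym (!-++ˡ b rest i<)) (lookup bounded (!-∈ b i<))
  ; hits = λ v< → let i , i< , b!i≡v = ∈⇒index (pigeonhole unique bounded length≡ v<)
                  in i , i< , trans (!-++ˡ b rest i<) b!i≡v
  }
  where open SAvWord B

raise-lower : ∀ k rest → (∀ {x} → x < length rest → k ≤ rest ! x) → map (k +_) (map (_∸ k) rest) ≡ rest
raise-lower k [] large = refl
raise-lower k (r ∷ rest) large = cong₂ _∷_ (m+[n∸m]≡n (large z<s)) (raise-lower k rest (λ x< → large (s≤s x<)))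

peel-block : ∀ {b} → SAvWord b (length b) → ∀ rest →
             SAvPerm ((b ++ rest) !_) (length b + length rest) →
             ∃[ ys ] rest ≡ map (length b +_) ys × length ys ≡ length rest × SAvPerm (ys !_) (length rest)
peel-block {b} B rest H = ys , sym (raise-lower k rest rest-large) , length-map _ rest , Peel.peel H P (ys !_) ys≡
  where
  k = length b
  ys = map (_∸ k) rest
  P = block-prefix B rest
  ys≡ : ∀ {x} → x < length rest → ys ! x ≡ (b ++ rest) ! (k + x) ∸ k
  ys≡ {x} x< = trans (!-map (_∸ k) rest x<) (cong (_∸ k) (sym (!-++ʳ b rest x)))
  rest-large : ∀ {x} → x < length rest → k ≤ rest ! x
  rest-large {x} x< = subst (k ≤_) (!-++ʳ b rest x) (Peel.tail-large H P x<)

prefix-of : ∀ b xs → length b ≤ length xs → (∀ {i} → i < length b → xs ! i ≡ b ! i) → ∃[ rest ] xs ≡ b ++ rest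
prefix-of [] xs _ _ = xs , refl
prefix-of (c ∷ b) (x ∷ xs) (s≤s len≤) agree with agree z<s | prefix-of b xs len≤ (λ i< → agree (s≤s i<))
... | refl | rest , refl = rest , refl

agree₁ : ∀ xs {a} → xs ! 0 ≡ a → ∀ {i} → i < 1 → xs ! i ≡ (a ∷ []) ! i
agree₁ xs e {zero} _ = e
agree₁ xs e {suc _} (s≤s ())

agree₂ : ∀ xs {a b} → xs ! 0 ≡ a → xs ! 1 ≡ b → ∀ {i} → i < 2 → xs ! i ≡ (a ∷ b ∷ []) ! i
agree₂ xs e₀ e₁ {zero} _ = e₀
agree₂ xs e₀ e₁ {suc zero} _ = e₁
agree₂ xs e₀ e₁ {suc (suc _)} (s≤s (s≤s ()))

agree₃ : ∀ xs {a b c} → xs ! 0 ≡ a → xs ! 1 ≡ b → xs ! 2 ≡ c →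
         ∀ {i} → i < 3 → xs ! i ≡ (a ∷ b ∷ c ∷ []) ! i
agree₃ xs e₀ e₁ e₂ {zero} _ = e₀
agree₃ xs e₀ e₁ e₂ {suc zero} _ = e₁
agree₃ xs e₀ e₁ e₂ {suc (suc zero)} _ = e₂
agree₃ xs e₀ e₁ e₂ {suc (suc (suc _))} (s≤s (s≤s (s≤s ())))

Complete : ℕ → Set
Complete n = ∀ xs → length xs ≡ n → SAvPerm (xs !_) n → xs ∈ blockWords n

-- A word starting with the block b lies in blockWords, provided all shorter
-- SAv permutations do: peel b off and glue it back onto the shorter word.
complete-after : ∀ {b} → SAvWord b (length b) → 0 < length b →
                 (∀ m {ys} → ys ∈ blockWords m → glue (length b) b ys ∈ blockWords (length b + m)) →
                 ∀ {n} xs → length xs ≡ n → SAvPerm (xs !_) n →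
                 length b ≤ n → (∀ {i} → i < length b → xs ! i ≡ b ! i) →
                 (∀ {m} → m < n → Complete m) → xs ∈ blockWords n
complete-after {b} B 0<b ∈-glued xs refl H b≤n agree shorter with prefix-of b xs b≤n agree
... | rest , refl with peel-block B rest (subst (SAvPerm _) (length-++ b) H)
...   | ys , refl , ys-length , Hys =
        subst (λ N → glue (length b) b ys ∈ blockWords N) (sym (length-++ b))
          (∈-glued _ (shorter rest<xs ys ys-length Hys))
  where
  rest<xs = subst (length (map (length b +_) ys) <_) (sym (length-++ b)) (m<n+m _ 0<b)

-- Completeness, by strong induction on n: by the first-block lemma the word
-- starts with one of the blocks, whose length bounds n from below because
-- its entries are values of π.
blockWords-complete : ∀ n → Complete n
blockWords-complete = <-rec Complete step
  where
  step : ∀ n → (∀ {m} → m < n → Complete m) → Complete n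
  step zero _ [] refl _ = here refl
  step (suc n) shorter xs len H with FirstBlockLemma.firstBlock H z<s
  ... | inj₁ π0≡0 =
    complete-after block0 z<s ∈-block1 xs len H (s≤s z≤n) (agree₁ xs π0≡0) shorter
  ... | inj₂ (inj₁ (π0≡1 , π1≡0)) =
    complete-after block10 z<s ∈-block10 xs len H (value<size H z<s π0≡1) (agree₂ xs π0≡1 π1≡0) shorter
  ... | inj₂ (inj₂ (inj₁ (π0≡1 , π1≡2 , π2≡0))) =
    complete-after block120 z<s ∈-block120 xs len H (value<size H (value<size H z<s π0≡1) π1≡2)
      (agree₃ xs π0≡1 π1≡2 π2≡0) shorter
  ... | inj₂ (inj₂ (inj₂ (π0≡2 , π1≡0 , π2≡1))) =
    complete-after block201 z<s ∈-block201 xs len H (value<size H z<s π0≡2) (agree₃ xs π0≡2 π1≡0 π2≡1) shorter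

enc : ∀ {n k} → Vec (Fin n) k → List ℕ
enc w = map toℕ (Vec.toList w)

map-toList : ∀ {A B : Set} {k} (g : A → B) (w : Vec A k) → map g (Vec.toList w) ≡ List.tabulate (g ∘ Vec.lookup w)
map-toList g Vec.[] = refl
map-toList g (x Vec.∷ w) = cong (g x ∷_) (map-toList g w)

enc-lookup : ∀ {n k} (w : Vec (Fin n) k) (i : Fin k) → toℕ (Vec.lookup w i) ≡ enc w ! toℕ i
enc-lookup (x Vec.∷ w) fzero = refl
enc-lookup (x Vec.∷ w) (fsuc i) = enc-lookup w i

enc-square : ∀ {n} (w : Vec (Fin n) n) → enc (square w) ≡ squareL (enc w)
enc-square w = begin
  map toℕ (Vec.toList (Vec.tabulate w²))            ≡⟨ map-toList toℕ (Vec.tabulate w²) ⟩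
  List.tabulate (toℕ ∘ Vec.lookup (Vec.tabulate w²)) ≡⟨ tabulate-cong (cong toℕ ∘ Vec.lookup∘tabulate w²) ⟩
  List.tabulate (toℕ ∘ w²)                           ≡⟨ tabulate-cong (enc-lookup w ∘ Vec.lookup w) ⟩
  List.tabulate ((enc w !_) ∘ toℕ ∘ Vec.lookup w)    ≡⟨ sym (map-toList ((enc w !_) ∘ toℕ) w) ⟩
  map ((enc w !_) ∘ toℕ) (Vec.toList w)              ≡⟨ map-∘ (Vec.toList w) ⟩
  squareL (enc w)                                    ∎
  where
  open ≡-Reasoning
  w² = λ i → Vec.lookup w (Vec.lookup w i)

enc-injective : ∀ {n k} {w w' : Vec (Fin n) k} → enc w ≡ enc w' → w ≡ w'
enc-injective {w = Vec.[]} {Vec.[]} _ = refl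
enc-injective {w = x Vec.∷ w} {y Vec.∷ w'} eq =
  cong₂ Vec._∷_ (toℕ-injective (∷-injectiveˡ eq)) (enc-injective (∷-injectiveʳ eq))

enc-length : ∀ {n k} (w : Vec (Fin n) k) → length (enc w) ≡ k
enc-length Vec.[] = refl
enc-length (x Vec.∷ w) = cong suc (enc-length w)

enc-bounded : ∀ {n k} (w : Vec (Fin n) k) → All (_< n) (enc w)
enc-bounded Vec.[] = []
enc-bounded (x Vec.∷ w) = toℕ<n x ∷ enc-bounded w

decode : ∀ {n} xs → All (_< n) xs → Vec (Fin n) (length xs)
decode [] [] = Vec.[]
decode (x ∷ xs) (x< ∷ xs<) = fromℕ< x< Vec.∷ decode xs xs<

enc-decode : ∀ {n} xs (xs< : All (_< n) xs) → enc (decode xs xs<) ≡ xs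
enc-decode [] [] = refl
enc-decode (x ∷ xs) (x< ∷ xs<) = cong₂ _∷_ (toℕ-fromℕ< x<) (enc-decode xs xs<)

allWords-complete : ∀ {n k} (w : Vec (Fin n) k) → w ∈ allWords n k
allWords-complete Vec.[] = here refl
allWords-complete (x Vec.∷ w) = ∈-concat⁺′ (∈-map⁺ (x Vec.∷_) (allWords-complete w)) (∈-map⁺ _ (∈-allFin x))

allWords-unique : ∀ n k → Unique (allWords n k)
allWords-unique n zero = [] ∷ []
allWords-unique n (suc k) =
  Unique.concat⁺ (All.map⁺ (All-tabulate (λ _ → Unique.map⁺ Vec.∷-injectiveʳ (allWords-unique n k))))
                 (AllPairs.map⁺ (AllPairs-map disjoint (Unique.allFin⁺ n)))
  where
  disjoint : ∀ {x y} → x ≢ y → ∀ {v} → ¬ (v ∈ map (x Vec.∷_) (allWords n k) × v ∈ map (y Vec.∷_) (allWords n k))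
  disjoint x≢y (v∈x , v∈y) with ∈-map⁻ _ v∈x | ∈-map⁻ _ v∈y
  ... | _ , _ , refl | _ , _ , eq = x≢y (cong Vec.head eq)

encoded : ∀ {n} xs → length xs ≡ n → All (_< n) xs → ∃[ w ] w ∈ allWords n n × enc w ≡ xs
encoded xs refl xs< = decode xs xs< , allWords-complete (decode xs xs<) , enc-decode xs xs<

T-not : ∀ {b} → T (not b) → ¬ T b
T-not {false} _ ()

not-T : ∀ {b} → ¬ T b → T (not b)
not-T {false} _ = tt
not-T {true} ¬t = ⊥-elim (¬t tt)

T-∧-intro : ∀ {a b} → T a → T b → T (a ∧ b)
T-∧-intro ta tb = Equivalence.from T-∧ (ta , tb)

distinct⇒Unique : ∀ xs → T (distinct xs) → Unique xs
distinct⇒Unique [] _ = []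
distinct⇒Unique (x ∷ xs) t =
  All-map (λ t' x≡y → T-not t' (≡⇒≡ᵇ _ _ x≡y)) (All.all⁺ _ xs (∧-fst t)) ∷ distinct⇒Unique xs (∧-snd t)

Unique⇒distinct : ∀ xs → Unique xs → T (distinct xs)
Unique⇒distinct [] _ = tt
Unique⇒distinct (x ∷ xs) (x∉ ∷ unique) =
  T-∧-intro (All.all⁻ _ (All-map (λ x≢y → not-T (x≢y ∘ ≡ᵇ⇒≡ _ _)) x∉)) (Unique⇒distinct xs unique)

avoidsBoth : List ℕ → Bool
avoidsBoth xs = not (containsL xs p321) ∧ (not (containsL xs p3412) ∧ true)

avoidsBoth⇒Avoids : ∀ xs → T (avoidsBoth xs) → Avoids xs
avoidsBoth⇒Avoids xs t =
  T-not (∧-fst t) ∘ has321⇒contains , T-not (∧-fst (∧-snd {not (containsL xs p321)} t)) ∘ has3412⇒contains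

Avoids⇒avoidsBoth : ∀ xs → Avoids xs → T (avoidsBoth xs)
Avoids⇒avoidsBoth xs (no321 , no3412) =
  T-∧-intro (not-T (no321 ∘ contains⇒has321 xs)) (T-∧-intro (not-T (no3412 ∘ contains⇒has3412 xs)) tt)

inSAv⇒SAvWord : ∀ {n} (w : Vec (Fin n) n) → T (inSAv (p321 ∷ p3412 ∷ []) w) → SAvWord (enc w) n
inSAv⇒SAvWord w t = record
  { length≡ = enc-length w
  ; bounded = enc-bounded w
  ; unique = distinct⇒Unique (enc w) (∧-fst {distinct (enc w)} t)
  ; pattern-free = avoidsBoth⇒Avoids (enc w) (∧-fst {avoidsBoth (enc w)} avoidance)
  ; square-pattern-free = subst Avoids (enc-square w)
      (avoidsBoth⇒Avoids (enc (square w)) (∧-snd {avoidsBoth (enc w)} avoidance))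
  }
  where avoidance = ∧-snd {distinct (enc w)} t

SAvWord⇒inSAv : ∀ {n} (w : Vec (Fin n) n) → SAvWord (enc w) n → T (inSAv (p321 ∷ p3412 ∷ []) w)
SAvWord⇒inSAv w W =
  T-∧-intro (Unique⇒distinct (enc w) unique)
    (T-∧-intro (Avoids⇒avoidsBoth (enc w) pattern-free)
               (Avoids⇒avoidsBoth (enc (square w)) (subst Avoids (sym (enc-square w)) square-pattern-free)))
  where open SAvWord W

SAvList : (n : ℕ) → List (Vec (Fin n) n)
SAvList n = filter (λ w → T? (inSAv (p321 ∷ p3412 ∷ []) w)) (allWords n n)

encodedSAv : ℕ → List (List ℕ)
encodedSAv n = map enc (SAvList n)

encodedSAv-unique : ∀ n → Unique (encodedSAv n)
encodedSAv-unique n = Unique.map⁺ enc-injective (Unique.filter⁺ _ (allWords-unique n n))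

encodedSAv⊆blockWords : ∀ {n xs} → xs ∈ encodedSAv n → xs ∈ blockWords n
encodedSAv⊆blockWords {n} xs∈ with ∈-map⁻ enc xs∈
... | w , w∈ , refl with ∈-filter⁻ _ {xs = allWords n n} w∈
...   | _ , t = blockWords-complete n (enc w) (enc-length w) (SAvWord⇒SAvPerm (inSAv⇒SAvWord w t))

blockWords⊆encodedSAv : ∀ {n xs} → xs ∈ blockWords n → xs ∈ encodedSAv n
blockWords⊆encodedSAv {n} {xs} xs∈ with blockWords-sound n xs∈
... | W with encoded xs (SAvWord.length≡ W) (SAvWord.bounded W)
...   | w , w∈ , refl = ∈-map⁺ enc (∈-filter⁺ _ w∈ (SAvWord⇒inSAv w W))

-- The theorem: |SAv_n(321, 3412)| = c(n), the coefficient of xⁿ in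
-- 1/(1 − x − x² − 2x³).
theorem1p4 : (n : ℕ) → 1 ≤ n → sav (p321 ∷ p3412 ∷ []) n ≡ coeff n
theorem1p4 n _ = begin
  sav (p321 ∷ p3412 ∷ []) n   ≡⟨ sym (length-map enc (SAvList n)) ⟩
  length (encodedSAv n)        ≡⟨ same-members-same-length (encodedSAv-unique n) (unique-blockWords n)
                                    encodedSAv⊆blockWords blockWords⊆encodedSAv ⟩
  length (blockWords n)        ≡⟨ length-blockWords n ⟩
  coeff n                      ∎
  where open ≡-Reasoning
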